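{- Let $T$ be the graph with vertex set $\{x,u,v\}\cup\{x_i:1\leqslant i\leqslant 8\}$ (eleven distinct vertices) and edge set $\{uv,vx_1,vx_2,vx_3,vx_4,ux_5,ux_6,ux_7,ux_8\}\cup\{xx_i:1\leqslant i\leqslant 8\}$. Then for every $n\geqslant 1$, the augmented cube $AQ_n$ has no subgraph isomorphic to $T$.
   Context: The $n$-dimensional augmented cube $AQ_n$ has as vertices all $n$-bit binary strings $a_na_{n-1}\ldots a_1$. $AQ_1=K_2$. For $n\geqslant 2$, $AQ_n$ is obtained from two copies $AQ^0_{n-1}$ (vertices $0a_{n-1}\ldots a_1$) and $AQ^1_{n-1}$ (vertices $1b_{n-1}\ldots b_1$) of $AQ_{n-1}$ by joining $0a_{n-1}\ldots a_1$ to $1b_{n-1}\ldots b_1$ iff either $a_i=b_i$ for all $1\leqslant i\leqslant n-1$ or $a_i=1-b_i$ for all $1\leqslant i\leqslant n-1$. Equivalently, for $u=u_n\ldots u_1$, writing $u^i$ for $u$ with bit $i$ flipped and $\overline{u}^i$ for $u$ with bits $1,\ldots,i$ all flipped, $N_{AQ_n}(u)=\{u^i:1\leqslant i\leqslant n\}\cup\{\overline{u}^i:2\leqslant i\leqslant n\}$. -}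

module Defs where

open import Data.Nat using (ℕ; zero; suc)
open import Data.Bool using (Bool; not)
open import Data.Vec using (Vec; []; _∷_; map)
open import Data.Fin using (Fin; #_)
open import Data.List using (List; []; _∷_)
open import Data.List.Membership.Propositional using (_∈_)
open import Data.Product using (_×_; _,_)
open import Data.Sum using (_⊎_)
open import Data.Empty using (⊥)
open import Relation.Binary.PropositionalEquality using (_≡_; _≢_)
open import Function.Definitions using (Injective)

-- Vertices of AQ_n: n-bit strings a_n a_{n-1} ... a_1, stored with the
-- most significant bit a_n at the head of the vector.
Vertex : ℕ → Set
Vertex n = Vec Bool n

-- Adjacency in AQ_n, following the recursive definition:
-- AQ_1 = K_2; for n ≥ 2, two vertices with equal leading bit are adjacent iff
-- adjacent in the copy AQ_{n-1}; with different leading bits they are adjacent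
-- iff the remaining bits are equal or complementary.
-- (AQ_0 is not defined in the paper; we give it no edges, it is never used.)
AQAdj : (n : ℕ) → Vertex n → Vertex n → Set
AQAdj zero _ _ = ⊥
AQAdj (suc zero) (a ∷ []) (b ∷ []) = a ≢ b
AQAdj (suc (suc n)) (a ∷ u) (b ∷ v) =
  (a ≡ b × AQAdj (suc n) u v) ⊎ (a ≢ b × (u ≡ v ⊎ u ≡ map not v))

-- The graph T on 11 vertices:  0 = x, 1 = u, 2 = v, 3..10 = x_1..x_8.
TEdges : List (Fin 11 × Fin 11)
TEdges =
  (# 1 , # 2) ∷
  (# 2 , # 3) ∷ (# 2 , # 4) ∷ (# 2 , # 5) ∷ (# 2 , # 6) ∷
  (# 1 , # 7) ∷ (# 1 , # 8) ∷ (# 1 , # 9) ∷ (# 1 , # 10) ∷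
  (# 0 , # 3) ∷ (# 0 , # 4) ∷ (# 0 , # 5) ∷ (# 0 , # 6) ∷
  (# 0 , # 7) ∷ (# 0 , # 8) ∷ (# 0 , # 9) ∷ (# 0 , # 10) ∷ []

-- A (not necessarily induced) subgraph of AQ_n isomorphic to T is exactly an
-- injective vertex map Fin 11 → Vertex n sending every edge of T to an edge of AQ_n.
record TSubgraph (n : ℕ) : Set where
  field
    embed     : Fin 11 → Vertex n
    injective : Injective _≡_ _≡_ embed
    edges     : ∀ {i j} → (i , j) ∈ TEdges → AQAdj n (embed i) (embed j)

-- AQ_n is a Cayley graph of (ℤ₂)ⁿ, so translating by x we may assume x = 0.
-- Then u and v become generators a and b with a ⊕ b a generator, and the
-- leaves x₁..x₄ (x₅..x₈) give four distinct common neighbours of 0 and b (of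
-- 0 and a). Two facts about the generating set finish the proof: 0 and any
-- d ≠ 0 have at most four common neighbours, and if both a and b have four,
-- then some w is a common neighbour of 0, a and b at once. By the first fact
-- w is a leaf at v and a leaf at u, which are disjoint sets of leaves.
module Submission where

open import Defs
open import Data.Nat using (ℕ; _≥_)
open import Relation.Nullary using (¬_)

open import Data.Bool using (Bool; true; false; not; _xor_)
import Data.Bool as Bool
open import Data.Bool.Properties
  using (xor-same; xor-comm; xor-assoc; xor-identityˡ; xor-identityʳ;
         xor-inverseˡ; xor-inverseʳ)
open import Data.Empty using (⊥; ⊥-elim)
open import Data.Fin using (Fin; zero; suc; #_; _↑ˡ_; _↑ʳ_; splitAt)
import Data.Fin.Properties as Fin
import Data.List.Relation.Unary.Any as List
import Data.Product.Properties as Product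
open import Data.List.Membership.DecPropositional
  (Product.≡-dec (Fin._≟_ {11}) (Fin._≟_ {11})) using (_∈_; _∈?_)
open import Data.Nat as ℕ using (_+_; _≤_; s≤s)
open import Data.Nat.Properties using (≮⇒≥; n≮n)
open import Data.Product using (Σ-syntax; ∃; _×_; _,_; proj₁; proj₂)
open import Data.Sum using (_⊎_; inj₁; inj₂; [_,_]′)
open import Data.Vec using (Vec; []; _∷_; map; replicate; zipWith; lookup)
import Data.Vec.Functional as Vector
open import Data.Vec.Membership.Propositional using () renaming (_∈_ to _∈ᵥ_)
open import Data.Vec.Membership.Propositional.Properties
  using (∈-++⁺ˡ; ∈-++⁺ʳ; ∈-map⁺)
open import Data.Vec.Properties
  using (zipWith-comm; zipWith-assoc; zipWith-identityˡ; zipWith-identityʳ;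
         zipWith-inverseˡ; zipWith-inverseʳ; zipWith-replicate₁; map-replicate)
import Data.Vec.Properties as Vec
import Data.Vec.Relation.Unary.Any as Any
open Any using (here; there)
open import Data.Vec.Relation.Unary.Any.Properties using (lookup-index)
open import Function using (_∘_; case_of_)
open import Function.Definitions using (Injective)
open import Relation.Binary.PropositionalEquality
open import Relation.Nullary using (Dec; yes; no)
open import Relation.Nullary.Decidable
  using (_⊎-dec_; _×-dec_; toWitness; decidable-stable)

private
  variable
    A : Set
    n m k l : ℕ

pigeonhole-∈ : {f : Fin n → A} (xs : Vec A m) →
  Injective _≡_ _≡_ f → (∀ i → f i ∈ᵥ xs) → n ≤ m
pigeonhole-∈ {f = f} xs f-inj f∈xs = ≮⇒≥ λ m<n →
  let i , j , i<j , same-index = Fin.pigeonhole m<n (Any.index ∘ f∈xs)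
  in Fin.<⇒≢ i<j (f-inj (begin
       f i                              ≡⟨ lookup-index (f∈xs i) ⟩
       lookup xs (Any.index (f∈xs i))   ≡⟨ cong (lookup xs) same-index ⟩
       lookup xs (Any.index (f∈xs j))   ≡⟨ lookup-index (f∈xs j) ⟨
       f j                              ∎))
  where open ≡-Reasoning

∷-injective : {w : A} {f : Fin n → A} → (∀ i → w ≢ f i) →
  Injective _≡_ _≡_ f → Injective _≡_ _≡_ (w Vector.∷ f)
∷-injective w∉f f-inj {zero}  {zero}  _  = refl
∷-injective w∉f f-inj {zero}  {suc j} eq = ⊥-elim (w∉f j eq)
∷-injective w∉f f-inj {suc i} {zero}  eq = ⊥-elim (w∉f i (sym eq))
∷-injective w∉f f-inj {suc i} {suc j} eq = cong suc (f-inj eq)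

infixl 6 _⊕_

_⊕_ : Vertex n → Vertex n → Vertex n
_⊕_ = zipWith _xor_

zeros ones : Vertex n
zeros = replicate _ false
ones  = replicate _ true

_≟_ : (x y : Vertex n) → Dec (x ≡ y)
_≟_ = Vec.≡-dec Bool._≟_

⊕-comm : (x y : Vertex n) → x ⊕ y ≡ y ⊕ x
⊕-comm = zipWith-comm xor-comm

⊕-assoc : (x y z : Vertex n) → (x ⊕ y) ⊕ z ≡ x ⊕ (y ⊕ z)
⊕-assoc = zipWith-assoc xor-assoc

⊕-identityˡ : (x : Vertex n) → zeros ⊕ x ≡ x
⊕-identityˡ = zipWith-identityˡ xor-identityˡ

⊕-identityʳ : (x : Vertex n) → x ⊕ zeros ≡ x
⊕-identityʳ = zipWith-identityʳ xor-identityʳ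

⊕-self : (x : Vertex n) → x ⊕ x ≡ zeros
⊕-self []      = refl
⊕-self (a ∷ x) = cong₂ _∷_ (xor-same a) (⊕-self x)

ones-⊕ : (x : Vertex n) → ones ⊕ x ≡ map not x
ones-⊕ = zipWith-replicate₁ _xor_ true

complement-⊕ : (x : Vertex n) → map not x ⊕ x ≡ ones
complement-⊕ = zipWith-inverseˡ xor-inverseˡ

⊕-complement : (x : Vertex n) → x ⊕ map not x ≡ ones
⊕-complement = zipWith-inverseʳ xor-inverseʳ

complement-ones : map not (ones {n}) ≡ zeros
complement-ones = map-replicate not true _

x⊕[x⊕y]≡y : (x y : Vertex n) → x ⊕ (x ⊕ y) ≡ y
x⊕[x⊕y]≡y x y = begin
  x ⊕ (x ⊕ y)  ≡⟨ ⊕-assoc x x y ⟨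
  (x ⊕ x) ⊕ y  ≡⟨ cong (_⊕ y) (⊕-self x) ⟩
  zeros ⊕ y    ≡⟨ ⊕-identityˡ y ⟩
  y            ∎
  where open ≡-Reasoning

x⊕y≡z⇒y≡x⊕z : {x y z : Vertex n} → x ⊕ y ≡ z → y ≡ x ⊕ z
x⊕y≡z⇒y≡x⊕z {x = x} {y} eq = trans (sym (x⊕[x⊕y]≡y x y)) (cong (x ⊕_) eq)

⊕-cancelˡ : (x : Vertex n) {y z : Vertex n} → x ⊕ y ≡ x ⊕ z → y ≡ z
⊕-cancelˡ x {z = z} eq = trans (x⊕y≡z⇒y≡x⊕z eq) (x⊕[x⊕y]≡y x z)

[x⊕y]⊕[x⊕z]≡y⊕z : (x y z : Vertex n) → (x ⊕ y) ⊕ (x ⊕ z) ≡ y ⊕ z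
[x⊕y]⊕[x⊕z]≡y⊕z x y z = begin
  (x ⊕ y) ⊕ (x ⊕ z)  ≡⟨ cong (_⊕ (x ⊕ z)) (⊕-comm x y) ⟩
  (y ⊕ x) ⊕ (x ⊕ z)  ≡⟨ ⊕-assoc y x (x ⊕ z) ⟩
  y ⊕ (x ⊕ (x ⊕ z))  ≡⟨ cong (y ⊕_) (x⊕[x⊕y]≡y x z) ⟩
  y ⊕ z              ∎
  where open ≡-Reasoning

⊕≡zeros⇒≡ : {x y : Vertex n} → x ⊕ y ≡ zeros → x ≡ y
⊕≡zeros⇒≡ {x = x} eq = sym (trans (x⊕y≡z⇒y≡x⊕z eq) (⊕-identityʳ x))

⊕≡ones⇒complement : {x y : Vertex n} → x ⊕ y ≡ ones → y ≡ map not x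
⊕≡ones⇒complement {x = x} eq =
  trans (x⊕y≡z⇒y≡x⊕z eq) (trans (⊕-comm x ones) (ones-⊕ x))

⊕≡self⇒zeros : {x y : Vertex n} → x ⊕ y ≡ x → y ≡ zeros
⊕≡self⇒zeros {x = x} eq = ⊕-cancelˡ x (trans eq (sym (⊕-identityʳ x)))

tail≢zeros : {x : Vertex n} → false ∷ x ≢ zeros → x ≢ zeros
tail≢zeros = _∘ cong (false ∷_)

⊕≢zeros : {x y : Vertex n} → x ≢ y → x ⊕ y ≢ zeros
⊕≢zeros x≢y = x≢y ∘ ⊕≡zeros⇒≡

-- The generators u ⊕ uⁱ (a single 1) and u ⊕ ūⁱ (the bits i..1 all 1) of AQ_n
-- as a Cayley graph: after the leading zeros, a 1 followed by all 0s or all 1s.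
IsGenerator : Vertex n → Set
IsGenerator []          = ⊥
IsGenerator (true ∷ r)  = r ≡ zeros ⊎ r ≡ ones
IsGenerator (false ∷ r) = IsGenerator r

isGenerator? : (x : Vertex n) → Dec (IsGenerator x)
isGenerator? []          = no λ ()
isGenerator? (true ∷ r)  = r ≟ zeros ⊎-dec r ≟ ones
isGenerator? (false ∷ r) = isGenerator? r

¬isGenerator-zeros : ¬ IsGenerator (zeros {n})
¬isGenerator-zeros {ℕ.suc n} = ¬isGenerator-zeros {n}

isGenerator-ones : (x : Vertex n) → IsGenerator x → IsGenerator (ones {n})
isGenerator-ones (_ ∷ _) _ = inj₂ refl

xor≡true : {a b : Bool} → a ≢ b → a xor b ≡ true
xor≡true {true}  {true}  a≢b = ⊥-elim (a≢b refl)
xor≡true {true}  {false} _   = refl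
xor≡true {false} {true}  _   = refl
xor≡true {false} {false} a≢b = ⊥-elim (a≢b refl)

twin⇒⊕ : {u v : Vertex n} → u ≡ v ⊎ u ≡ map not v →
  u ⊕ v ≡ zeros ⊎ u ⊕ v ≡ ones
twin⇒⊕ {v = v} (inj₁ refl) = inj₁ (⊕-self v)
twin⇒⊕ {v = v} (inj₂ refl) = inj₂ (complement-⊕ v)

adjacent⇒isGenerator : (n : ℕ) {p q : Vertex n} →
  AQAdj n p q → IsGenerator (p ⊕ q)
adjacent⇒isGenerator (ℕ.suc ℕ.zero) {a ∷ []} {b ∷ []} a≢b
  rewrite xor≡true a≢b = inj₁ refl
adjacent⇒isGenerator (ℕ.suc (ℕ.suc n)) {a ∷ u} {b ∷ v} (inj₁ (refl , adj))
  rewrite xor-same a = adjacent⇒isGenerator (ℕ.suc n) adj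
adjacent⇒isGenerator (ℕ.suc (ℕ.suc n)) {a ∷ u} {b ∷ v} (inj₂ (a≢b , twin))
  rewrite xor≡true a≢b = twin⇒⊕ twin

CommonNbr : Vertex n → Vertex n → Set
CommonNbr d s = IsGenerator s × IsGenerator (s ⊕ d)

CommonNbrs : ℕ → Vertex n → Set
CommonNbrs {n} k d =
  Σ[ f ∈ (Fin k → Vertex n) ] Injective _≡_ _≡_ f × (∀ i → CommonNbr d (f i))

commonNbr-translate : {x y c : Vertex n} →
  IsGenerator (x ⊕ y) → IsGenerator (c ⊕ y) → CommonNbr (x ⊕ c) (x ⊕ y)
commonNbr-translate {x = x} {y} {c} x~y c~y =
  x~y , subst IsGenerator (sym (trans ([x⊕y]⊕[x⊕z]≡y⊕z x y c) (⊕-comm y c))) c~y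

commonNbrs-translate : {x c : Vertex n} (y : Fin k → Vertex n) → Injective _≡_ _≡_ y →
  (∀ i → IsGenerator (x ⊕ y i)) → (∀ i → IsGenerator (c ⊕ y i)) →
  CommonNbrs k (x ⊕ c)
commonNbrs-translate {x = x} {c} y y-inj x~y c~y =
  (λ i → x ⊕ y i) , y-inj ∘ ⊕-cancelˡ x ,
  λ i → commonNbr-translate {x = x} {y i} {c} (x~y i) (c~y i)

commonNbr-true∷zeros : {d : Vertex n} → IsGenerator d →
  CommonNbr (true ∷ d) (true ∷ zeros)
commonNbr-true∷zeros {d = d} d-gen =
  inj₁ refl , subst IsGenerator (sym (⊕-identityˡ d)) d-gen

commonNbr-true∷ : {d : Vertex n} {s : Vertex (ℕ.suc n)} → CommonNbr (true ∷ d) s →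
  IsGenerator d × s ∈ᵥ (true ∷ zeros) ∷ (false ∷ d) ∷ [] ⊎
  IsGenerator (map not d) × s ∈ᵥ (true ∷ ones) ∷ (false ∷ map not d) ∷ []
commonNbr-true∷ {d = d} {true ∷ _} (inj₁ refl , s~d) =
  inj₁ (subst IsGenerator (⊕-identityˡ d) s~d , here refl)
commonNbr-true∷ {d = d} {true ∷ _} (inj₂ refl , s~d) =
  inj₂ (subst IsGenerator (ones-⊕ d) s~d , here refl)
commonNbr-true∷ {s = false ∷ r} (r-gen , inj₁ r⊕d≡0)
  with ⊕≡zeros⇒≡ r⊕d≡0
... | refl = inj₁ (r-gen , there (here refl))
commonNbr-true∷ {d = d} {false ∷ r} (r-gen , inj₂ r⊕d≡1)
  with ⊕≡ones⇒complement (trans (⊕-comm d r) r⊕d≡1)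
... | refl = inj₂ (r-gen , there (here refl))

commonNbr-false∷ : {d : Vertex n} {s : Vertex (ℕ.suc n)} →
  CommonNbr (false ∷ d) s →
  (∃ λ t → s ≡ false ∷ t × CommonNbr d t) ⊎
  s ∈ᵥ (true ∷ zeros) ∷ (true ∷ ones) ∷ [] × (d ≡ zeros ⊎ d ≡ ones)
commonNbr-false∷ {s = false ∷ t} t~d = inj₁ (t , refl , t~d)
commonNbr-false∷ {d = d} {true ∷ _} (inj₁ refl , s~d) rewrite ⊕-identityˡ d =
  inj₂ (here refl , s~d)
commonNbr-false∷ {s = true ∷ _} (inj₂ refl , inj₁ 1⊕d≡0) =
  inj₂ (there (here refl) , inj₂ (sym (⊕≡zeros⇒≡ 1⊕d≡0)))
commonNbr-false∷ {s = true ∷ _} (inj₂ refl , inj₂ 1⊕d≡1) =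
  inj₂ (there (here refl) , inj₁ (⊕≡self⇒zeros 1⊕d≡1))

commonNbr-ones : {t : Vertex (ℕ.suc n)} → CommonNbr ones t →
  t ∈ᵥ (true ∷ zeros) ∷ (false ∷ ones) ∷ []
commonNbr-ones {n = n} t~1 with commonNbr-true∷ t~1
... | inj₁ (_ , t∈) = t∈
... | inj₂ (1̄-gen , _) =
  ⊥-elim (¬isGenerator-zeros {n} (subst IsGenerator (complement-ones {n}) 1̄-gen))

commonNbr-strip : {d : Vertex n} {s : Vertex (ℕ.suc n)} → d ≢ zeros → d ≢ ones →
  CommonNbr (false ∷ d) s → ∃ λ t → s ≡ false ∷ t × CommonNbr d t
commonNbr-strip d≢0 d≢1 s~d with commonNbr-false∷ s~d
... | inj₁ stripped          = stripped
... | inj₂ (_ , inj₁ d≡0) = ⊥-elim (d≢0 d≡0)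
... | inj₂ (_ , inj₂ d≡1) = ⊥-elim (d≢1 d≡1)

commonNbrs-strip : {d : Vertex n} → d ≢ zeros → d ≢ ones →
  CommonNbrs k (false ∷ d) → CommonNbrs k d
commonNbrs-strip d≢0 d≢1 (f , f-inj , f~d) =
  proj₁ ∘ stripped , stripped-inj , proj₂ ∘ proj₂ ∘ stripped
  where
  stripped = λ i → commonNbr-strip d≢0 d≢1 (f~d i)
  stripped-inj : Injective _≡_ _≡_ (proj₁ ∘ stripped)
  stripped-inj {i} {j} eq = f-inj (begin
    f i                        ≡⟨ proj₁ (proj₂ (stripped i)) ⟩
    false ∷ proj₁ (stripped i) ≡⟨ cong (false ∷_) eq ⟩
    false ∷ proj₁ (stripped j) ≡⟨ proj₁ (proj₂ (stripped j)) ⟨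
    f j                        ∎)
    where open ≡-Reasoning

commonNbr-false∷ones : {s : Vertex (2 + n)} → CommonNbr (false ∷ ones) s →
  s ∈ᵥ (true ∷ zeros) ∷ (true ∷ ones) ∷
       map (false ∷_) ((true ∷ zeros) ∷ (false ∷ ones) ∷ [])
commonNbr-false∷ones {s = s} s~d with commonNbr-false∷ {s = s} s~d
... | inj₁ (t , refl , t~1) = there (there (∈-map⁺ (false ∷_) (commonNbr-ones t~1)))
... | inj₂ (s∈ , _)         = ∈-++⁺ˡ s∈

commonNbrs-≤4 : {d : Vertex n} → d ≢ zeros → CommonNbrs k d → k ≤ 4
commonNbrs-≤4 {d = []} d≢0 _ = ⊥-elim (d≢0 refl)
commonNbrs-≤4 {d = true ∷ d} _ (f , f-inj , f~d) =
  pigeonhole-∈ (_ ∷ _ ∷ _ ∷ _ ∷ []) f-inj λ i → [ ∈-++⁺ˡ ∘ proj₂ , ∈-++⁺ʳ (_ ∷ _ ∷ []) ∘ proj₂ ]′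
    (commonNbr-true∷ (f~d i))
commonNbrs-≤4 {d = false ∷ d} d≢0 F with d ≟ ones
... | no d≢1 = commonNbrs-≤4 d≢0′ (commonNbrs-strip d≢0′ d≢1 F)
  where d≢0′ = tail≢zeros d≢0
commonNbrs-≤4 {d = false ∷ []} d≢0 _ | yes _ = ⊥-elim (d≢0 refl)
commonNbrs-≤4 {d = false ∷ _ ∷ _} _ (f , f-inj , f~d) | yes refl =
  pigeonhole-∈ _ f-inj (commonNbr-false∷ones ∘ f~d)

commonNbrs-complete : {d : Vertex n} → d ≢ zeros → (F : CommonNbrs 4 d) →
  (w : Vertex n) → CommonNbr d w → ∃ λ i → w ≡ proj₁ F i
commonNbrs-complete d≢0 (f , f-inj , f~d) w w~d with Fin.any? (λ i → w ≟ f i)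
... | yes found = found
... | no w∉f =
  ⊥-elim (n≮n 4 (commonNbrs-≤4 d≢0 (w Vector.∷ f , w∷f-inj , w∷f~d)))
  where
  w∷f-inj = ∷-injective (λ i w≡fi → w∉f (i , w≡fi)) f-inj
  w∷f~d : ∀ i → CommonNbr _ ((w Vector.∷ f) i)
  w∷f~d zero    = w~d
  w∷f~d (suc i) = f~d i

commonNbrs-true∷ : {d : Vertex n} → CommonNbrs (3 + k) (true ∷ d) →
  IsGenerator d × IsGenerator (map not d)
commonNbrs-true∷ {n = n} {d = d} (f , f-inj , f~d) = d-gen , d̄-gen
  where
  two-candidates : {xs : Vec (Vertex (ℕ.suc n)) 2} → ¬ (∀ i → f i ∈ᵥ xs)
  two-candidates {xs} f∈xs with pigeonhole-∈ xs f-inj f∈xs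
  ... | s≤s (s≤s ())
  d-gen : IsGenerator d
  d-gen = decidable-stable (isGenerator? d) λ ¬d-gen → two-candidates λ i →
    [ ⊥-elim ∘ ¬d-gen ∘ proj₁ , proj₂ ]′ (commonNbr-true∷ (f~d i))
  d̄-gen : IsGenerator (map not d)
  d̄-gen = decidable-stable (isGenerator? (map not d)) λ ¬d̄-gen → two-candidates λ i →
    [ proj₂ , ⊥-elim ∘ ¬d̄-gen ∘ proj₁ ]′ (commonNbr-true∷ (f~d i))

SharedCommonNbr : Vertex n → Vertex n → Set
SharedCommonNbr a b = ∃ λ w → CommonNbr a w × CommonNbr b w

sharedCommonNbr-sym : {a b : Vertex n} → SharedCommonNbr a b → SharedCommonNbr b a
sharedCommonNbr-sym (w , w~a , w~b) = w , w~b , w~a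

sharedCommonNbr-true∷-false∷ : {a b : Vertex n} → a ⊕ b ≡ zeros ⊎ a ⊕ b ≡ ones →
  IsGenerator a → IsGenerator (map not a) → SharedCommonNbr (true ∷ a) (false ∷ b)
sharedCommonNbr-true∷-false∷ {a = a} (inj₁ a⊕b≡0) a-gen ā-gen
  with ⊕≡zeros⇒≡ a⊕b≡0
... | refl = false ∷ map not a , (ā-gen , inj₂ (complement-⊕ a)) ,
             (ā-gen , subst IsGenerator (sym (complement-⊕ a)) (isGenerator-ones a a-gen))
sharedCommonNbr-true∷-false∷ {a = a} (inj₂ a⊕b≡1) a-gen ā-gen
  with ⊕≡ones⇒complement a⊕b≡1
... | refl = false ∷ a , (a-gen , inj₁ (⊕-self a)) ,
             (a-gen , subst IsGenerator (sym (⊕-complement a)) (isGenerator-ones a a-gen))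

sharedCommonNbr-false∷ones : {b : Vertex n} → b ≢ zeros → b ≢ ones →
  IsGenerator (ones ⊕ b) → CommonNbrs (3 + k) (false ∷ b) →
  SharedCommonNbr (false ∷ ones) (false ∷ b)
sharedCommonNbr-false∷ones {b = []} b≢0 _ _ _ = ⊥-elim (b≢0 refl)
sharedCommonNbr-false∷ones {b = false ∷ []} b≢0 _ _ _ = ⊥-elim (b≢0 refl)
sharedCommonNbr-false∷ones {b = true ∷ []} _ b≢1 _ _ = ⊥-elim (b≢1 refl)
sharedCommonNbr-false∷ones {b = false ∷ b@(_ ∷ _)} _ _ (inj₁ 1⊕b≡0) _
  with ⊕≡zeros⇒≡ {x = ones} {b} 1⊕b≡0
... | refl = false ∷ true ∷ zeros , commonNbr-true∷zeros {d = ones} (inj₂ refl) ,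
             (inj₁ refl , inj₂ (⊕-identityˡ ones))
sharedCommonNbr-false∷ones {b = false ∷ b@(_ ∷ _)} b≢0 _ (inj₂ 1⊕b≡1) _ =
  ⊥-elim (b≢0 (cong (false ∷_) (⊕≡self⇒zeros 1⊕b≡1)))
sharedCommonNbr-false∷ones {b = true ∷ b@(_ ∷ _)} _ b≢1 _ B =
  false ∷ true ∷ zeros , commonNbr-true∷zeros {d = ones} (inj₂ refl) ,
  commonNbr-true∷zeros {d = b} (proj₁ (commonNbrs-true∷ (commonNbrs-strip (λ ()) b≢1 B)))

sharedCommonNbr : {a b : Vertex n} → a ≢ zeros → b ≢ zeros → IsGenerator (a ⊕ b) →
  CommonNbrs (3 + k) a → CommonNbrs (3 + l) b → SharedCommonNbr a b
sharedCommonNbr {a = []} a≢0 _ _ _ _ = ⊥-elim (a≢0 refl)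
sharedCommonNbr {a = true ∷ a} {true ∷ b} _ _ _ A B =
  true ∷ zeros , commonNbr-true∷zeros (proj₁ (commonNbrs-true∷ A)) ,
                 commonNbr-true∷zeros (proj₁ (commonNbrs-true∷ B))
sharedCommonNbr {a = true ∷ a} {false ∷ b} _ _ a⊕b A _ =
  let a-gen , ā-gen = commonNbrs-true∷ A
  in sharedCommonNbr-true∷-false∷ a⊕b a-gen ā-gen
sharedCommonNbr {a = false ∷ a} {true ∷ b} _ _ a⊕b _ B =
  let b-gen , b̄-gen = commonNbrs-true∷ B
      b⊕a = subst (λ c → c ≡ zeros ⊎ c ≡ ones) (⊕-comm a b) a⊕b
  in sharedCommonNbr-sym (sharedCommonNbr-true∷-false∷ b⊕a b-gen b̄-gen)
sharedCommonNbr {a = false ∷ a} {false ∷ b} a≢0 b≢0 a⊕b A B with a ≟ ones | b ≟ ones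
... | yes refl | yes refl = let f , _ , f~a = A in f zero , f~a zero , f~a zero
... | yes refl | no b≢1 = sharedCommonNbr-false∷ones (tail≢zeros b≢0) b≢1 a⊕b B
... | no a≢1 | yes refl = sharedCommonNbr-sym (sharedCommonNbr-false∷ones
  (tail≢zeros a≢0) a≢1 (subst IsGenerator (⊕-comm a ones) a⊕b) A)
... | no a≢1 | no b≢1 =
  let w , w~a , w~b = sharedCommonNbr a≢0′ b≢0′ a⊕b
                        (commonNbrs-strip a≢0′ a≢1 A) (commonNbrs-strip b≢0′ b≢1 B)
  in false ∷ w , w~a , w~b
  where
  a≢0′ = tail≢zeros a≢0
  b≢0′ = tail≢zeros b≢0

leaf : Fin 8 → Fin 11
leaf = 3 ↑ʳ_

vLeaf uLeaf : Fin 4 → Fin 11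
vLeaf k = leaf (k ↑ˡ 4)
uLeaf k = leaf (4 ↑ʳ k)

vLeaf-injective : Injective _≡_ _≡_ vLeaf
vLeaf-injective = Fin.↑ˡ-injective 4 _ _ ∘ Fin.↑ʳ-injective 3 _ _

uLeaf-injective : Injective _≡_ _≡_ uLeaf
uLeaf-injective = Fin.↑ʳ-injective 4 _ _ ∘ Fin.↑ʳ-injective 3 _ _

vLeaf≢uLeaf : ∀ i j → vLeaf i ≢ uLeaf j
vLeaf≢uLeaf i j eq with
  trans (sym (Fin.splitAt-↑ˡ 4 i 4))
        (trans (cong (splitAt 4) (Fin.↑ʳ-injective 3 _ _ eq)) (Fin.splitAt-↑ʳ 4 4 j))
... | ()

vLeaf-edges : ∀ k → (# 0 , vLeaf k) ∈ TEdges × (# 2 , vLeaf k) ∈ TEdges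
vLeaf-edges = toWitness
  {a? = Fin.all? λ k → (# 0 , vLeaf k) ∈? TEdges ×-dec (# 2 , vLeaf k) ∈? TEdges} _

uLeaf-edges : ∀ k → (# 0 , uLeaf k) ∈ TEdges × (# 1 , uLeaf k) ∈ TEdges
uLeaf-edges = toWitness
  {a? = Fin.all? λ k → (# 0 , uLeaf k) ∈? TEdges ×-dec (# 1 , uLeaf k) ∈? TEdges} _

lemma4p8 : (n : ℕ) → n ≥ 1 → ¬ TSubgraph n
lemma4p8 n _ T =
  let w , w~a , w~b = sharedCommonNbr a≢0 b≢0 a⊕b uLeaves vLeaves
      j , w≡uLeaf = commonNbrs-complete a≢0 uLeaves w w~a
      i , w≡vLeaf = commonNbrs-complete b≢0 vLeaves w w~b
  in vLeaf≢uLeaf i j (injective (⊕-cancelˡ x (trans (sym w≡vLeaf) w≡uLeaf)))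
  where
  open TSubgraph T
  x = embed (# 0)
  a = x ⊕ embed (# 1)
  b = x ⊕ embed (# 2)
  edge : ∀ {i j} → (i , j) ∈ TEdges → IsGenerator (embed i ⊕ embed j)
  edge = adjacent⇒isGenerator n ∘ edges
  a≢0 : a ≢ zeros
  a≢0 = ⊕≢zeros λ x≡u → case injective x≡u of λ ()
  b≢0 : b ≢ zeros
  b≢0 = ⊕≢zeros λ x≡v → case injective x≡v of λ ()
  a⊕b : IsGenerator (a ⊕ b)
  a⊕b = subst IsGenerator (sym ([x⊕y]⊕[x⊕z]≡y⊕z x _ _)) (edge (List.here refl))
  uLeaves : CommonNbrs 4 a
  uLeaves = commonNbrs-translate (embed ∘ uLeaf) (uLeaf-injective ∘ injective)
    (edge ∘ proj₁ ∘ uLeaf-edges) (edge ∘ proj₂ ∘ uLeaf-edges)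
  vLeaves : CommonNbrs 4 b
  vLeaves = commonNbrs-translate (embed ∘ vLeaf) (vLeaf-injective ∘ injective)
    (edge ∘ proj₁ ∘ vLeaf-edges) (edge ∘ proj₂ ∘ vLeaf-edges)
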